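{- Let $(\cdot)^{\star}:V^{\star}\to\mathcal{X}$ be a bijection, and define a binary relation $\in^{\star}$ on $V^{\star}$ by $\mathsf{c}_j\in^{\star}\mathsf{c}_k$ iff $\mathsf{c}_j\in\mathsf{c}_k^{\star}$, for all $j,k\in\mathbb{Z}$. Then $(V^{\star},\in^{\star})\models\mathsf{WD}+\mathsf{EXT}+\mathsf{BU}+\mathsf{BI}$.
   Context: For each $k\in\mathbb{Z}$ let $\mathsf{c}_k$ be a distinct constant symbol, and $V^{\star}=\{\mathsf{c}_k:k\in\mathbb{Z}\}$. Let $\omega$ be the set of nonnegative integers and $\mathcal{X}$ the set of all $X\subseteq V^{\star}$ such that the symmetric difference of $X$ and $\{\mathsf{c}_k:k\in\omega\}$ is finite. $\mathsf{WD}$ is the theory with the two axioms $\forall x y\,\exists z\,\forall u\,[u\in z\leftrightarrow(u\in x\vee u=y)]$ and $\forall x y\,\exists z\,\forall u\,[u\in z\leftrightarrow(u\in x\wedge u\neq y)]$. $\mathsf{EXT}$ is extensionality $\forall x y\,[\forall u\,(u\in x\leftrightarrow u\in y)\rightarrow x=y]$. $\mathsf{BU}$ is $\forall x y\,\exists z\,\forall u\,[u\in z\leftrightarrow(u\in x\vee u\in y)]$ and $\mathsf{BI}$ is $\forall x y\,\exists z\,\forall u\,[u\in z\leftrightarrow(u\in x\wedge u\in y)]$. -}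

module Defs where

open import Data.Bool using (Bool; true; false)
open import Data.Integer using (ℤ; +_; -[1+_])
open import Data.List using (List)
open import Data.List.Membership.Propositional using (_∈_)
open import Data.Product using (Σ; ∃; _×_)
open import Data.Sum using (_⊎_)
open import Relation.Nullary using (¬_)
open import Relation.Binary.PropositionalEquality using (_≡_)
open import Function.Bundles using (_⇔_)

-- The constants c_k are identified with their index k ∈ ℤ, so V* = ℤ.
-- Subsets of V* are represented as characteristic functions ℤ → Bool,
-- compared extensionally (pointwise).
Subset : Set
Subset = ℤ → Bool

_≗ˢ_ : Subset → Subset → Set
X ≗ˢ Y = ∀ k → X k ≡ Y k

ωset : Subset
ωset (+ _)     = true
ωset -[1+ _ ]  = false

-- X ∈ 𝒳 : the symmetric difference of X and ω is finite, i.e. contained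
-- in some finite list of indices.
In𝒳 : Subset → Set
In𝒳 X = Σ (List ℤ) λ L → ∀ k → ¬ (k ∈ L) → X k ≡ ωset k

-- (·)* : V* → 𝒳 is a bijection (𝒳 taken up to extensional equality).
record IsStarBijection (star : ℤ → Subset) : Set where
  field
    into       : ∀ k → In𝒳 (star k)
    injective  : ∀ j k → star j ≗ˢ star k → j ≡ k
    surjective : ∀ X → In𝒳 X → Σ ℤ λ k → star k ≗ˢ X

_∈⋆[_]_ : ℤ → (ℤ → Subset) → ℤ → Set
j ∈⋆[ star ] k = star k j ≡ true

-- Satisfaction of the axioms in a structure (D, R), R u x meaning "u ∈ x".
module _ {D : Set} (R : D → D → Set) where
  WD : Set
  WD = (∀ x y → ∃ λ z → ∀ u → R u z ⇔ (R u x ⊎ u ≡ y))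
     × (∀ x y → ∃ λ z → ∀ u → R u z ⇔ (R u x × ¬ (u ≡ y)))

  EXT : Set
  EXT = ∀ x y → (∀ u → R u x ⇔ R u y) → x ≡ y

  BU : Set
  BU = ∀ x y → ∃ λ z → ∀ u → R u z ⇔ (R u x ⊎ R u y)

  BI : Set
  BI = ∀ x y → ∃ λ z → ∀ u → R u z ⇔ (R u x × R u y)

  Models-WD+EXT+BU+BI : Set
  Models-WD+EXT+BU+BI = WD × EXT × BU × BI

-- Every set in 𝒳 agrees with ω outside a finite set of indices, so 𝒳 is closed
-- under adjoining or removing one element and under finite unions and
-- intersections (outside both exceptional sets the two arguments agree with ω,
-- and ∨, ∧ are idempotent). Surjectivity of (·)* turns each such set into an
-- element of V* with the required ∈*-extension; injectivity gives EXT.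
module Submission where

open import Defs
open import Data.Bool using (Bool; true; false; T; not; _∨_; _∧_)
open import Data.Bool.Properties using (T-≡; T-∨; T-∧; ∨-idem; ∧-idem; ∨-identityʳ; ∧-identityʳ; ⇔→≡)
open import Data.Integer using (ℤ; _≟_)
open import Data.List using (List; _++_; [_])
open import Data.List.Membership.Propositional using (_∉_)
open import Data.List.Membership.Propositional.Properties using (∈-++⁺ˡ; ∈-++⁺ʳ)
open import Data.List.Relation.Unary.Any using (here)
open import Data.Product using (∃; _,_)
open import Data.Product.Function.NonDependent.Propositional using (_×-⇔_)
open import Data.Sum.Function.Propositional using (_⊎-⇔_)
open import Function using (_∘_)
open import Function.Bundles using (_⇔_; mk⇔)
open import Function.Construct.Composition using (_⇔-∘_)
open import Function.Construct.Symmetry using (⇔-sym)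
open import Relation.Nullary using (Dec; ¬_)
open import Relation.Nullary.Decidable
  using (isYes; isNo; True; False; isYes≗does; dec-false; toWitness; fromWitness; toWitnessFalse; fromWitnessFalse)
open import Relation.Binary.PropositionalEquality using (_≡_; sym; trans; cong; cong₂; subst; module ≡-Reasoning)

open ≡-Reasoning

In𝒳-pointwise : (f : Bool → Bool → Bool) → (∀ b → f b b ≡ b) →
                ∀ {X Y} → In𝒳 X → In𝒳 Y → In𝒳 (λ k → f (X k) (Y k))
In𝒳-pointwise f f-idem {X} {Y} (L , X≈ω) (M , Y≈ω) = L ++ M , agrees
  where
  agrees : ∀ k → k ∉ L ++ M → f (X k) (Y k) ≡ ωset k
  agrees k k∉ = begin
    f (X k) (Y k)          ≡⟨ cong₂ f (X≈ω k (k∉ ∘ ∈-++⁺ˡ)) (Y≈ω k (k∉ ∘ ∈-++⁺ʳ L)) ⟩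
    f (ωset k) (ωset k)    ≡⟨ f-idem (ωset k) ⟩
    ωset k                 ∎

In𝒳-agreeOutside : ∀ {X Y} (M : List ℤ) → (∀ k → k ∉ M → Y k ≡ X k) → In𝒳 X → In𝒳 Y
In𝒳-agreeOutside M Y≈X (L , X≈ω) =
  L ++ M , λ k k∉ → trans (Y≈X k (k∉ ∘ ∈-++⁺ʳ L)) (X≈ω k (k∉ ∘ ∈-++⁺ˡ))

isYes-≟-∉[_] : ∀ y {k} → k ∉ [ y ] → isYes (k ≟ y) ≡ false
isYes-≟-∉[ y ] {k} k∉ = trans (isYes≗does (k ≟ y)) (dec-false (k ≟ y) (k∉ ∘ here))

True⇔ : ∀ {A : Set} (a? : Dec A) → True a? ⇔ A
True⇔ _ = mk⇔ toWitness fromWitness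

False⇔ : ∀ {A : Set} (a? : Dec A) → False a? ⇔ (¬ A)
False⇔ _ = mk⇔ toWitnessFalse fromWitnessFalse

module _ {star : ℤ → Subset} (star-bij : IsStarBijection star) where
  open IsStarBijection star-bij

  comprehension : ∀ {P : ℤ → Set} X → In𝒳 X → (∀ u → T (X u) ⇔ P u) →
                  ∃ λ z → ∀ u → u ∈⋆[ star ] z ⇔ P u
  comprehension X X∈𝒳 X⇔P with surjective X X∈𝒳
  ... | z , z⋆≗X = z , λ u → subst (λ b → T b ⇔ _) (sym (z⋆≗X u)) (X⇔P u) ⇔-∘ ⇔-sym T-≡

  adjoin remove : ℤ → ℤ → Subset
  adjoin x y u = star x u ∨ isYes (u ≟ y)
  remove x y u = star x u ∧ isNo (u ≟ y)

  adjoin∈𝒳 : ∀ x y → In𝒳 (adjoin x y)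
  adjoin∈𝒳 x y = In𝒳-agreeOutside [ y ] agrees (into x)
    where
    agrees : ∀ k → k ∉ [ y ] → adjoin x y k ≡ star x k
    agrees k k∉ = begin
      star x k ∨ isYes (k ≟ y)  ≡⟨ cong (star x k ∨_) (isYes-≟-∉[ y ] k∉) ⟩
      star x k ∨ false          ≡⟨ ∨-identityʳ (star x k) ⟩
      star x k                  ∎

  remove∈𝒳 : ∀ x y → In𝒳 (remove x y)
  remove∈𝒳 x y = In𝒳-agreeOutside [ y ] agrees (into x)
    where
    agrees : ∀ k → k ∉ [ y ] → remove x y k ≡ star x k
    agrees k k∉ = begin
      star x k ∧ isNo (k ≟ y)   ≡⟨ cong (λ b → star x k ∧ not b) (isYes-≟-∉[ y ] k∉) ⟩
      star x k ∧ true           ≡⟨ ∧-identityʳ (star x k) ⟩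
      star x k                  ∎

  models-WD : WD (_∈⋆[ star ]_)
  models-WD =
    (λ x y → comprehension (adjoin x y) (adjoin∈𝒳 x y) λ u → (T-≡ ⊎-⇔ True⇔ (u ≟ y)) ⇔-∘ T-∨) ,
    (λ x y → comprehension (remove x y) (remove∈𝒳 x y) λ u → (T-≡ ×-⇔ False⇔ (u ≟ y)) ⇔-∘ T-∧)

  models-EXT : EXT (_∈⋆[ star ]_)
  models-EXT x y same = injective x y (λ u → ⇔→≡ (same u))

  models-BU : BU (_∈⋆[ star ]_)
  models-BU x y = comprehension _ (In𝒳-pointwise _∨_ ∨-idem (into x) (into y)) λ _ → (T-≡ ⊎-⇔ T-≡) ⇔-∘ T-∨

  models-BI : BI (_∈⋆[ star ]_)
  models-BI x y = comprehension _ (In𝒳-pointwise _∧_ ∧-idem (into x) (into y)) λ _ → (T-≡ ×-⇔ T-≡) ⇔-∘ T-∧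

lemma1 : (star : ℤ → Subset) → IsStarBijection star →
         Models-WD+EXT+BU+BI (λ j k → j ∈⋆[ star ] k)
lemma1 _ star-bij = models-WD star-bij , models-EXT star-bij , models-BU star-bij , models-BI star-bij
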